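{- Let $M$ be a matroid with ground set $E$ and rank function $r$, and let $k>0$ be an integer. Then every $\sigma\in\mathcal F_k$ is a subset of $\vec S_k$.
   Context: The connectivity function is $\lambda(X)=r(X)+r(E\setminus X)-r(M)$. $\vec U$ is the set of all ordered bipartitions $(X,Y)$ of $E$ ($X\cup Y=E$, $X\cap Y=\emptyset$, either part possibly empty), ordered by $(A,B)\le(C,D)$ iff $A\subseteq C$ and $B\supseteq D$, with inverse $(B,A)$ of $(A,B)$; $\mathrm{ord}(X,Y)=\lambda(X)=\lambda(Y)$. $\vec S_k=\{(A,B)\in\vec U:\mathrm{ord}(A,B)<k\}$. A star is a set $\sigma$ of elements of $\vec U$ with $(A,B)\ne(B,A)$ for each element and $(A,B)\le(D,C)$ for all distinct $(A,B),(C,D)\in\sigma$. For a star $\sigma=\{(A_i,B_i):i=0,\dots,n\}\subseteq\vec U$ let $\langle\sigma\rangle=r(M)+\sum_{i=0}^n(r(B_i)-r(M))$. $\mathcal F_k$ is the set of all stars $\sigma\subseteq\vec U$ with $\langle\sigma\rangle<k$. -}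

module Defs where

open import Data.Nat as ℕ using (ℕ)
open import Data.Integer as ℤ using (ℤ; +_; _+_; _-_; _<_)
open import Data.Fin.Subset using (Subset; _⊆_; _∪_; _∩_; ∣_∣; ⊤; ⊥)
open import Data.List using (List; map; foldr)
open import Data.List.Membership.Propositional using (_∈_)
open import Data.List.Relation.Unary.All using (All)
open import Data.List.Relation.Unary.Unique.Propositional using (Unique)
open import Data.Product using (_×_)
open import Relation.Binary.PropositionalEquality using (_≡_; _≢_)

record Matroid (n : ℕ) : Set where
  field
    r          : Subset n → ℕ
    r-bound    : ∀ X → r X ℕ.≤ ∣ X ∣
    r-mono     : ∀ {X Y} → X ⊆ Y → r X ℕ.≤ r Y
    r-submod   : ∀ X Y → r (X ∪ Y) ℕ.+ r (X ∩ Y) ℕ.≤ r X ℕ.+ r Y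

-- Elements of U⃗: ordered bipartitions (X , Y) of E (either part may be empty).
record OSep (n : ℕ) : Set where
  constructor osep
  field
    X     : Subset n
    Y     : Subset n
    .cover : X ∪ Y ≡ ⊤
    .disj  : X ∩ Y ≡ ⊥
open OSep public

inv : ∀ {n} → OSep n → OSep n
inv (osep A B c d) = osep B A (lem c) (lem′ d)
  where
  open import Data.Fin.Subset.Properties using (∪-comm; ∩-comm)
  open import Relation.Binary.PropositionalEquality using (trans)
  lem : A ∪ B ≡ ⊤ → B ∪ A ≡ ⊤
  lem e = trans (∪-comm B A) e
  lem′ : A ∩ B ≡ ⊥ → B ∩ A ≡ ⊥
  lem′ e = trans (∩-comm B A) e

_≤ₛ_ : ∀ {n} → OSep n → OSep n → Set
s ≤ₛ t = (X s ⊆ X t) × (Y t ⊆ Y s)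

module _ {n : ℕ} (M : Matroid n) where
  open Matroid M

  rM : ℤ
  rM = + r ⊤

  ord : OSep n → ℤ
  ord s = (+ r (X s) + + r (Y s)) - rM

  InS : ℤ → OSep n → Set
  InS k s = ord s < k

  record IsStar (σ : List (OSep n)) : Set where
    field
      distinct   : Unique σ
      nondegen   : ∀ {s} → s ∈ σ → s ≢ inv s
      pointing   : ∀ {s t} → s ∈ σ → t ∈ σ → s ≢ t → s ≤ₛ inv t

  ⟨_⟩ : List (OSep n) → ℤ
  ⟨ σ ⟩ = rM + foldr _+_ (+ 0) (map (λ s → + r (Y s) - rM) σ)

  InF : ℤ → List (OSep n) → Set
  InF k σ = IsStar σ × (⟨ σ ⟩ < k)

-- Order the star so that s comes first; ⟨σ⟩ does not depend on the order.
-- For a star, the small side X s lies in every big side Y t with t ≠ s, so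
-- r(X s) ≤ r(⋂_{t ≠ s} Y t).  Each time a further Y t is intersected, the
-- pair (Y t , current intersection) covers E, because the intersection
-- contains X t; submodularity then costs at most r(Y t) − r(M).  Summing,
-- ord s = r(X s) + r(Y s) − r(M) ≤ ⟨σ⟩ < k.
module Submission where

open import Defs
open import Data.Nat using (ℕ)
import Data.Nat as ℕ
import Data.Nat.Properties as ℕ
open import Data.Integer using (ℤ; +_; _<_; _≤_; _+_; _-_; -_; +≤+)
open import Data.Integer.Properties
  using (≤-trans; ≤-reflexive; ≤-<-trans; +-monoˡ-≤; +-monoʳ-≤; +-identityʳ; pos-+;
         +-0-isCommutativeMonoid; module ≤-Reasoning)
open import Data.Integer.Tactic.RingSolver using (solve-∀)
open import Data.Fin.Subset using (Subset; _∩_; _∪_; ⊤; _⊆_) renaming (_∈_ to _∈ₛ_)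
open import Data.Fin.Subset.Properties
  using (∈⊤; _∈?_; x∈p∩q⁺; x∈p∪q⁻; p⊆p∪q; q⊆p∪q)
open import Data.List using (List; []; _∷_; foldr; map)
open import Data.List.Membership.Propositional using (_∈_)
open import Data.List.Membership.Propositional.Properties using (∈-∃++)
open import Data.List.Relation.Unary.All as All using (All)
open import Data.List.Relation.Unary.AllPairs using (AllPairs; []; _∷_)
open import Data.List.Relation.Unary.Any using (here; there)
open import Data.List.Relation.Unary.Unique.Propositional using (Unique)
open import Data.List.Relation.Binary.Permutation.Propositional
  using (_↭_; ↭-sym; ↭⇒↭ₛ)
open import Data.List.Relation.Binary.Permutation.Propositional.Properties
  using (shift; ∈-resp-↭; map⁺)
import Data.List.Relation.Binary.Permutation.Setoid.Properties as Perm
open import Data.Product using (∃; _,_; proj₁)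
open import Data.Sum using (inj₁; inj₂)
open import Relation.Binary.Core using (Rel)
open import Relation.Binary.PropositionalEquality
  using (_≡_; _≢_; refl; sym; subst; subst₂; cong; setoid)
open import Relation.Nullary.Decidable using (recompute)

module _ {a ℓ} {A : Set a} {R : Rel A ℓ} where

  allPairs-of-distinct : ∀ {xs} → Unique xs →
                         (∀ {u v} → u ∈ xs → v ∈ xs → u ≢ v → R u v) → AllPairs R xs
  allPairs-of-distinct []              _ = []
  allPairs-of-distinct (x∉xs ∷ unique) R-distinct =
    All.tabulate (λ v∈xs → R-distinct (here refl) (there v∈xs) (All.lookup x∉xs v∈xs))
      ∷ allPairs-of-distinct unique (λ u∈ v∈ → R-distinct (there u∈) (there v∈))

∈⇒↭∷ : ∀ {a} {A : Set a} {x : A} {xs} → x ∈ xs → ∃ λ ys → xs ↭ x ∷ ys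
∈⇒↭∷ {x = x} x∈xs with ys , zs , refl ← ∈-∃++ x∈xs = _ , shift x ys zs

module _ {n : ℕ} where

  -- The cover field is irrelevant; membership in A ∪ B is decidable, hence recomputable.
  ⊤⊆X∪Y : (s : OSep n) → ⊤ ⊆ X s ∪ Y s
  ⊤⊆X∪Y (osep A B cover _) {i} _ = recompute (i ∈? (A ∪ B)) (subst (i ∈ₛ_) (sym cover) ∈⊤)

  X⊆⇒⊤⊆Y∪ : ∀ (s : OSep n) {W} → X s ⊆ W → ⊤ ⊆ Y s ∪ W
  X⊆⇒⊤⊆Y∪ s {W} X⊆W i∈⊤ with x∈p∪q⁻ (X s) (Y s) (⊤⊆X∪Y s i∈⊤)
  ... | inj₁ i∈X = q⊆p∪q (Y s) W (X⊆W i∈X)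
  ... | inj₂ i∈Y = p⊆p∪q W i∈Y

  ⋂Y : List (OSep n) → Subset n
  ⋂Y = foldr (λ s W → Y s ∩ W) ⊤

  ⊆-⋂Y : ∀ {Z τ} → All (λ t → Z ⊆ Y t) τ → Z ⊆ ⋂Y τ
  ⊆-⋂Y All.[]           _   = ∈⊤
  ⊆-⋂Y (Z⊆Yt All.∷ Z⊆τ) i∈Z = x∈p∩q⁺ (Z⊆Yt i∈Z , ⊆-⋂Y Z⊆τ i∈Z)

-- Integer bookkeeping for the two rank estimates below; e plays the role of r(M).
intersect-step : ∀ {a b e w S} → a + e ≤ b + w → w ≤ e + S → a ≤ e + ((b - e) + S)
intersect-step {a} {b} {e} {w} {S} a+e≤b+w w≤e+S = begin
  a                     ≡⟨ cancel a e ⟩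
  (a + e) - e           ≤⟨ +-monoˡ-≤ (- e) a+e≤b+w ⟩
  (b + w) - e           ≤⟨ +-monoˡ-≤ (- e) (+-monoʳ-≤ b w≤e+S) ⟩
  (b + (e + S)) - e     ≡⟨ rearrange b e S ⟩
  e + ((b - e) + S)     ∎
  where
  open ≤-Reasoning
  cancel : ∀ a e → a ≡ (a + e) - e
  cancel = solve-∀
  rearrange : ∀ b e S → (b + (e + S)) - e ≡ e + ((b - e) + S)
  rearrange = solve-∀

separate-step : ∀ {x y e S} → x ≤ e + S → (x + y) - e ≤ e + ((y - e) + S)
separate-step {x} {y} {e} {S} x≤e+S = begin
  (x + y) - e           ≤⟨ +-monoˡ-≤ (- e) (+-monoˡ-≤ y x≤e+S) ⟩
  ((e + S) + y) - e     ≡⟨ rearrange e S y ⟩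
  e + ((y - e) + S)     ∎
  where
  open ≤-Reasoning
  rearrange : ∀ e S y → ((e + S) + y) - e ≡ e + ((y - e) + S)
  rearrange = solve-∀

module _ {n : ℕ} (M : Matroid n) where
  open Matroid M

  r-∩-of-cover : ∀ {A B} → ⊤ ⊆ A ∪ B → r (A ∩ B) ℕ.+ r ⊤ ℕ.≤ r A ℕ.+ r B
  r-∩-of-cover {A} {B} ⊤⊆A∪B = begin
    r (A ∩ B) ℕ.+ r ⊤         ≤⟨ ℕ.+-monoʳ-≤ (r (A ∩ B)) (r-mono ⊤⊆A∪B) ⟩
    r (A ∩ B) ℕ.+ r (A ∪ B)   ≡⟨ ℕ.+-comm (r (A ∩ B)) (r (A ∪ B)) ⟩
    r (A ∪ B) ℕ.+ r (A ∩ B)   ≤⟨ r-submod A B ⟩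
    r A ℕ.+ r B               ∎
    where open ℕ.≤-Reasoning

  excess : OSep n → ℤ
  excess s = + r (Y s) - rM M

  ∑excess : List (OSep n) → ℤ
  ∑excess τ = foldr _+_ (+ 0) (map excess τ)

  r-⋂Y≤ : ∀ {τ} → AllPairs (λ u v → u ≤ₛ inv v) τ → + r (⋂Y τ) ≤ rM M + ∑excess τ
  r-⋂Y≤ {[]}    []                = ≤-reflexive (sym (+-identityʳ (rM M)))
  r-⋂Y≤ {t ∷ τ} (t≤τ ∷ τ-pairs)   = intersect-step {b = + r (Y t)} {e = rM M}
    (subst₂ _≤_ (pos-+ (r (Y t ∩ ⋂Y τ)) (r ⊤)) (pos-+ (r (Y t)) (r (⋂Y τ)))
      (+≤+ (r-∩-of-cover (X⊆⇒⊤⊆Y∪ t (⊆-⋂Y (All.map proj₁ t≤τ))))))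
    (r-⋂Y≤ τ-pairs)

  ord≤⟨∷⟩ : ∀ {s τ} → AllPairs (λ u v → u ≤ₛ inv v) (s ∷ τ) → ord M s ≤ ⟨_⟩ M (s ∷ τ)
  ord≤⟨∷⟩ {s} (s≤τ ∷ τ-pairs) = separate-step {y = + r (Y s)} {e = rM M}
    (≤-trans (+≤+ (r-mono (⊆-⋂Y (All.map proj₁ s≤τ)))) (r-⋂Y≤ τ-pairs))

  ⟨⟩-resp-↭ : ∀ {σ τ} → σ ↭ τ → ⟨_⟩ M σ ≡ ⟨_⟩ M τ
  ⟨⟩-resp-↭ σ↭τ = cong (_+_ (rM M))
    (Perm.foldr-commMonoid (setoid ℤ) +-0-isCommutativeMonoid (↭⇒↭ₛ (map⁺ excess σ↭τ)))

  ord≤⟨⟩ : ∀ {σ s} → IsStar M σ → s ∈ σ → ord M s ≤ ⟨_⟩ M σ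
  ord≤⟨⟩ {σ} {s} star s∈σ with τ , σ↭s∷τ ← ∈⇒↭∷ s∈σ = begin
    ord M s          ≤⟨ ord≤⟨∷⟩ (allPairs-of-distinct unique pointing′) ⟩
    ⟨_⟩ M (s ∷ τ)    ≡⟨ sym (⟨⟩-resp-↭ σ↭s∷τ) ⟩
    ⟨_⟩ M σ          ∎
    where
    open ≤-Reasoning
    open IsStar star
    unique : Unique (s ∷ τ)
    unique = Perm.Unique-resp-↭ (setoid (OSep n)) (↭⇒↭ₛ σ↭s∷τ) distinct
    pointing′ : ∀ {u v} → u ∈ s ∷ τ → v ∈ s ∷ τ → u ≢ v → u ≤ₛ inv v
    pointing′ u∈ v∈ = pointing (∈-resp-↭ (↭-sym σ↭s∷τ) u∈) (∈-resp-↭ (↭-sym σ↭s∷τ) v∈)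

lemma8p2 : (n : ℕ) (M : Matroid n) (k : ℤ) → + 0 < k →
           (σ : List (OSep n)) → InF M k σ → All (InS M k) σ
lemma8p2 n M k _ σ (star , ⟨σ⟩<k) = All.tabulate (λ s∈σ → ≤-<-trans (ord≤⟨⟩ M star s∈σ) ⟨σ⟩<k)
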